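{- Let $L$ be a degree assignment for a graph $G$. Fix $v\in V(G)$ such that $G-v$ is connected, and fix $\alpha\in L(v)$. If there exists $w\in N(v)$ such that $\alpha\notin L(w)$, then $\mathcal{L}_{v,\alpha}$ mixes.
   Context: A list assignment $L$ assigns to each vertex $v$ a set $L(v)$ of colors; it is a degree assignment if $|L(v)|=d(v)$ for all $v$. An $L$-coloring is a proper coloring $\varphi$ with $\varphi(v)\in L(v)$ for all $v$. An $\alpha,\beta$-Kempe swap interchanges colors $\alpha,\beta$ on one connected component of the subgraph induced by vertices colored $\alpha$ or $\beta$; it is $L$-valid for $\varphi$ if the result is again an $L$-coloring. Two $L$-colorings are $L$-equivalent if one can be transformed into the other by a sequence of $L$-valid Kempe swaps (through arbitrary $L$-colorings of $G$). A set $\mathcal{L}'$ of $L$-colorings of $G$ mixes if every two colorings in $\mathcal{L}'$ are $L$-equivalent. $\mathcal{L}_{v,\alpha}$ denotes the set of all $L$-colorings $\varphi$ of $G$ with $\varphi(v)=\alpha$. -}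

module Defs where

open import Data.Nat using (ℕ; _≟_)
open import Data.Fin using (Fin)
open import Data.Bool using (Bool; true; false)
open import Data.List using (List; length; filterᵇ; allFin)
open import Data.List.Membership.Propositional using (_∈_)
open import Data.List.Relation.Unary.Unique.Propositional using (Unique)
open import Data.Product using (Σ; ∃; _×_; _,_)
open import Data.Sum using (_⊎_)
open import Relation.Nullary using (¬_; yes; no)
open import Relation.Binary.PropositionalEquality using (_≡_; _≢_)
open import Relation.Binary.Construct.Closure.ReflexiveTransitive using (Star)

record Graph (n : ℕ) : Set where
  field
    adj     : Fin n → Fin n → Bool
    adj-sym : ∀ u v → adj u v ≡ adj v u
    irrefl  : ∀ v → adj v v ≡ false
open Graph public

Adj : ∀ {n} → Graph n → Fin n → Fin n → Set
Adj G u v = adj G u v ≡ true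

degree : ∀ {n} → Graph n → Fin n → ℕ
degree {n} G v = length (filterᵇ (adj G v) (allFin n))

ListAssignment : ℕ → Set
ListAssignment n = Fin n → List ℕ

IsDegreeAssignment : ∀ {n} → Graph n → ListAssignment n → Set
IsDegreeAssignment G L = ∀ v → Unique (L v) × length (L v) ≡ degree G v

Coloring : ℕ → Set
Coloring n = Fin n → ℕ

IsLColoring : ∀ {n} → Graph n → ListAssignment n → Coloring n → Set
IsLColoring G L φ = (∀ u v → Adj G u v → φ u ≢ φ v) × (∀ v → φ v ∈ L v)

-- walks in G all of whose vertices satisfy P (walks in the subgraph induced by P)
data Walk {n : ℕ} (G : Graph n) (P : Fin n → Set) : Fin n → Fin n → Set where
  here : ∀ {x} → P x → Walk G P x x
  step : ∀ {x y z} → P x → Adj G x y → Walk G P y z → Walk G P x z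

swapC : ℕ → ℕ → ℕ → ℕ
swapC α β c with c ≟ α
... | yes _ = β
... | no _ with c ≟ β
...   | yes _ = α
...   | no _ = c

-- ψ is obtained from φ by an α,β-Kempe swap on the component of the
-- subgraph induced by colours α,β that contains vertex x
KempeSwapAt : ∀ {n} → Graph n → Coloring n → ℕ → ℕ → Fin n → Coloring n → Set
KempeSwapAt G φ α β x ψ =
  (φ x ≡ α ⊎ φ x ≡ β) ×
  (∀ u → (Walk G (λ w → φ w ≡ α ⊎ φ w ≡ β) x u → ψ u ≡ swapC α β (φ u))
       × (¬ Walk G (λ w → φ w ≡ α ⊎ φ w ≡ β) x u → ψ u ≡ φ u))

KempeSwap : ∀ {n} → Graph n → Coloring n → Coloring n → Set
KempeSwap G φ ψ = Σ ℕ λ α → Σ ℕ λ β → Σ (Fin _) λ x → KempeSwapAt G φ α β x ψ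

LKempeStep : ∀ {n} → Graph n → ListAssignment n → Coloring n → Coloring n → Set
LKempeStep G L φ ψ = KempeSwap G φ ψ × IsLColoring G L ψ

LEquivalent : ∀ {n} → Graph n → ListAssignment n → Coloring n → Coloring n → Set
LEquivalent G L φ ψ = Star (LKempeStep G L) φ ψ

Mixes : ∀ {n} → Graph n → ListAssignment n → (Coloring n → Set) → Set
Mixes G L S = ∀ φ ψ → IsLColoring G L φ → S φ → IsLColoring G L ψ → S ψ → LEquivalent G L φ ψ

Lvα : ∀ {n} → Fin n → ℕ → Coloring n → Set
Lvα v α φ = φ v ≡ α

ConnectedMinus : ∀ {n} → Graph n → Fin n → Set
ConnectedMinus G v = ∀ x y → x ≢ v → y ≢ v → Walk G (λ w → w ≢ v) x y

-- Order the vertices other than v so that each has a neighbour later in the order, ending with a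
-- neighbour w of v with α ∉ L w. As L is a degree assignment, every vertex y then has more colours
-- than neighbours that precede it or keep a colour from L y (v keeps α, which w cannot use).
-- Two L-colourings agreeing outside such an order are linked one vertex at a time: at the first
-- vertex x where φ and ψ differ, recolour the later vertices greedily into a colouring s and its
-- φ x,ψ x-Kempe swap d at x, with s agreeing with φ and d with ψ away from the later vertices;
-- the surplus of colours is exactly what keeps each greedy step possible. Induction on the later
-- vertices then links φ to s and d to ψ.

module Submission where

open import Defs
open import Level using (0ℓ)
open import Data.Bool using (Bool; true; false; if_then_else_) renaming (_≟_ to _≟B_)
open import Data.Nat using (ℕ; zero; suc; _+_; _≤_; _<_; z≤n; s≤s) renaming (_≟_ to _≟ℕ_)
open import Data.Nat.Properties using (≤-trans; m≤n⇒m≤1+n; <⇒≱; +-suc; m≤m+n; module ≤-Reasoning)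
open import Data.Fin using (Fin; zero; suc) renaming (_≟_ to _≟F_)
import Data.Fin.Properties as Finₚ
open import Data.List using (List; []; _∷_; length; filterᵇ; tabulate)
open import Data.List.Membership.Propositional using (_∈_; _∉_; find; lose)
import Data.List.Membership.DecPropositional as DecMembership
open import Data.List.Relation.Unary.Any using (here; there; any?; toSum)
import Data.List.Relation.Unary.All as All
open import Data.List.Relation.Unary.All.Properties using (All¬⇒¬Any; ¬Any⇒All¬)
open import Data.List.Relation.Unary.AllPairs using ([]; _∷_)
open import Data.List.Relation.Unary.Unique.Propositional using (Unique)
open import Data.Product using (Σ; ∃; ∃₂; _×_; _,_; proj₁; proj₂)
open import Data.Sum using (_⊎_; inj₁; inj₂; [_,_]′)
open import Data.Unit using (⊤; tt)
open import Data.Empty using (⊥; ⊥-elim)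
open import Data.Vec.Functional using (updateAt)
open import Data.Vec.Functional.Properties using (updateAt-updates; updateAt-minimal)
open import Function using (_∘_; id; const)
open import Relation.Nullary using (¬_; yes; no; does; ¬?; contradiction)
open import Relation.Nullary.Decidable using (_×-dec_; _⊎-dec_; decidable-stable)
open import Relation.Unary using (Pred; Decidable; _⊆_)
open import Relation.Binary.PropositionalEquality using (_≡_; _≢_; refl; sym; trans; cong; subst)
open import Relation.Binary.Construct.Closure.ReflexiveTransitive using (ε; _◅_; _◅◅_)

count : ∀ {n} {P : Pred (Fin n) 0ℓ} → Decidable P → ℕ
count {zero}  P? = 0
count {suc n} P? = (if does (P? zero) then suc else id) (count (P? ∘ suc))

count-mono : ∀ {n} {P Q : Pred (Fin n) 0ℓ} (P? : Decidable P) (Q? : Decidable Q) →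
             P ⊆ Q → count P? ≤ count Q?
count-mono {zero}  _  _  _   = z≤n
count-mono {suc n} P? Q? P⊆Q with P? zero | Q? zero
... | yes _ | yes _  = s≤s (count-mono (P? ∘ suc) (Q? ∘ suc) P⊆Q)
... | yes p | no ¬q  = contradiction (P⊆Q p) ¬q
... | no _  | yes _  = m≤n⇒m≤1+n (count-mono (P? ∘ suc) (Q? ∘ suc) P⊆Q)
... | no _  | no _   = count-mono (P? ∘ suc) (Q? ∘ suc) P⊆Q

count-< : ∀ {n} {P Q : Pred (Fin n) 0ℓ} (P? : Decidable P) (Q? : Decidable Q) →
          P ⊆ Q → ∀ {z} → Q z → ¬ P z → count P? < count Q?
count-< {suc n} P? Q? P⊆Q {zero} qz ¬pz with P? zero | Q? zero
... | yes pz | _     = contradiction pz ¬pz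
... | no _   | yes _ = s≤s (count-mono (P? ∘ suc) (Q? ∘ suc) P⊆Q)
... | no _   | no ¬q = contradiction qz ¬q
count-< {suc n} P? Q? P⊆Q {suc z} qz ¬pz with P? zero | Q? zero
... | yes _ | yes _ = s≤s (count-< (P? ∘ suc) (Q? ∘ suc) P⊆Q qz ¬pz)
... | yes p | no ¬q = contradiction (P⊆Q p) ¬q
... | no _  | yes _ = m≤n⇒m≤1+n (count-< (P? ∘ suc) (Q? ∘ suc) P⊆Q qz ¬pz)
... | no _  | no _  = count-< (P? ∘ suc) (Q? ∘ suc) P⊆Q qz ¬pz

count-⊤ : ∀ n → count {n} {λ _ → ⊤} (λ _ → yes tt) ≡ n
count-⊤ zero    = refl
count-⊤ (suc n) = cong suc (count-⊤ n)

length-filterᵇ-tabulate : ∀ {A : Set} {n} (p : A → Bool) (f : Fin n → A) →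
                          length (filterᵇ p (tabulate f)) ≡ count (λ i → p (f i) ≟B true)
length-filterᵇ-tabulate {n = zero}  p f = refl
length-filterᵇ-tabulate {n = suc n} p f with p (f zero)
... | true  = cong suc (length-filterᵇ-tabulate p (f ∘ suc))
... | false = length-filterᵇ-tabulate p (f ∘ suc)

-- h being a function, distinct entries have distinct witnesses.
length≤count : ∀ {A : Set} {n} {P : Pred (Fin n) 0ℓ} (P? : Decidable P) (h : Fin n → A) {xs : List A} →
               Unique xs → (∀ {t} → t ∈ xs → ∃ λ z → P z × h z ≡ t) → length xs ≤ count P?
length≤count P? h [] cover = z≤n
length≤count {P = P} P? h {t ∷ ts} (t∉ts ∷ unique) cover with cover (here refl)
... | z , pz , refl =
  ≤-trans (s≤s (length≤count P-z? h unique cover-ts)) (count-< P-z? P? proj₁ pz λ p → proj₂ p refl)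
  where
  P-z? : Decidable (λ i → P i × i ≢ z)
  P-z? i = P? i ×-dec ¬? (i ≟F z)
  cover-ts : ∀ {s} → s ∈ ts → ∃ λ i → (P i × i ≢ z) × h i ≡ s
  cover-ts s∈ts with cover (there s∈ts)
  ... | i , pi , refl = i , (pi , λ { refl → All.lookup t∉ts s∈ts refl }) , refl

length<n : ∀ {n} {R : List (Fin n)} {z} → Unique R → z ∉ R → length R < n
length<n {n} {R} {z} unique z∉R = begin-strict
  length R                  ≤⟨ length≤count (_∈? R) id unique (λ t∈R → _ , t∈R , refl) ⟩
  count (_∈? R)             <⟨ count-< (_∈? R) (λ _ → yes tt) _ tt z∉R ⟩
  count {n} (λ _ → yes tt)  ≡⟨ count-⊤ n ⟩
  n                         ∎
  where
  open ≤-Reasoning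
  open DecMembership (_≟F_ {n}) using (_∈?_)

swapC-α : ∀ α β → swapC α β α ≡ β
swapC-α α β with α ≟ℕ α
... | yes _   = refl
... | no α≢α  = contradiction refl α≢α

swapC-β : ∀ {α β} → α ≢ β → swapC α β β ≡ α
swapC-β {α} {β} α≢β with β ≟ℕ α
... | yes β≡α = contradiction (sym β≡α) α≢β
... | no _ with β ≟ℕ β
...   | yes _  = refl
...   | no β≢β = contradiction refl β≢β

swapC-self : ∀ α t → swapC α α t ≡ t
swapC-self α t with t ≟ℕ α
... | yes t≡α = sym t≡α
... | no _ with t ≟ℕ α
...   | yes t≡α = sym t≡α
...   | no _    = refl

module TwoColours {a c : ℕ} (a≢c : a ≢ c) where

  Swappable : Pred ℕ 0ℓ
  Swappable t = t ≡ a ⊎ t ≡ c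

  swappable? : Decidable Swappable
  swappable? t = (t ≟ℕ a) ⊎-dec (t ≟ℕ c)

  swap-swappable : ∀ {t} → Swappable t → Swappable (swapC a c t)
  swap-swappable (inj₁ refl) = inj₂ (swapC-α a c)
  swap-swappable (inj₂ refl) = inj₁ (swapC-β a≢c)

  swap-≢ : ∀ {t} → Swappable t → swapC a c t ≢ t
  swap-≢ (inj₁ refl) e = a≢c (trans (sym e) (swapC-α a c))
  swap-≢ (inj₂ refl) e = a≢c (trans (sym (swapC-β a≢c)) e)

  swap-involutive : ∀ {t} → Swappable t → swapC a c (swapC a c t) ≡ t
  swap-involutive (inj₁ refl) = trans (cong (swapC a c) (swapC-α a c)) (swapC-β a≢c)
  swap-involutive (inj₂ refl) = trans (cong (swapC a c) (swapC-β a≢c)) (swapC-α a c)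

  swappable-cases : ∀ {s t} → Swappable s → Swappable t → t ≡ s ⊎ t ≡ swapC a c s
  swappable-cases (inj₁ refl) (inj₁ refl) = inj₁ refl
  swappable-cases (inj₁ refl) (inj₂ refl) = inj₂ (sym (swapC-α a c))
  swappable-cases (inj₂ refl) (inj₁ refl) = inj₂ (sym (swapC-β a≢c))
  swappable-cases (inj₂ refl) (inj₂ refl) = inj₁ refl

Adj-sym : ∀ {n} (G : Graph n) {u z} → Adj G u z → Adj G z u
Adj-sym G {u} {z} u~z = trans (adj-sym G z u) u~z

Adj-irrefl : ∀ {n} (G : Graph n) {u} → ¬ Adj G u u
Adj-irrefl G {u} u~u with () ← trans (sym u~u) (irrefl G u)

Adj? : ∀ {n} (G : Graph n) u → Decidable (Adj G u)
Adj? G u z = adj G u z ≟B true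

degree≡count : ∀ {n} (G : Graph n) u → degree G u ≡ count (Adj? G u)
degree≡count G u = length-filterᵇ-tabulate (adj G u) id

module _ {n} {G : Graph n} where

  walk-map : ∀ {P Q : Pred (Fin n) 0ℓ} → P ⊆ Q → ∀ {x z} → Walk G P x z → Walk G Q x z
  walk-map P⊆Q (here p)       = here (P⊆Q p)
  walk-map P⊆Q (step p x~y w) = step (P⊆Q p) x~y (walk-map P⊆Q w)

  walk-head : ∀ {P : Pred (Fin n) 0ℓ} {x z} → Walk G P x z → P x
  walk-head (here p)     = p
  walk-head (step p _ _) = p

  walk-last : ∀ {P : Pred (Fin n) 0ℓ} {x z} → Walk G P x z → P z
  walk-last (here p)     = p
  walk-last (step _ _ w) = walk-last w

  walk-snoc : ∀ {P : Pred (Fin n) 0ℓ} {x z y} → Walk G P x z → Adj G z y → P y → Walk G P x y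
  walk-snoc (here p)       z~y py = step p z~y (here py)
  walk-snoc (step p x~w w) z~y py = step p x~w (walk-snoc w z~y py)

_[_]≔_ : ∀ {A : Set} {n} → (Fin n → A) → Fin n → A → Fin n → A
f [ i ]≔ a = updateAt f i (const a)

≔-updates : ∀ {A : Set} {n} (f : Fin n → A) i a → (f [ i ]≔ a) i ≡ a
≔-updates f i a = updateAt-updates i f

≔-minimal : ∀ {A : Set} {n} (f : Fin n → A) {i j} a → j ≢ i → (f [ i ]≔ a) j ≡ f j
≔-minimal f a j≢i = updateAt-minimal _ _ f j≢i

∉-∷ : ∀ {A : Set} {z y : A} {ys} → z ≢ y → z ∉ ys → z ∉ y ∷ ys
∉-∷ z≢y z∉ys = [ z≢y , z∉ys ]′ ∘ toSum

-- Without function extensionality, pointwise equal colourings are linked by swapping a colour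
-- with itself.
≗⇒LEquivalent : ∀ {n} {G : Graph n} {L φ ψ} → Fin n → IsLColoring G L ψ → (∀ z → φ z ≡ ψ z) →
                LEquivalent G L φ ψ
≗⇒LEquivalent {G = G} {φ = φ} {ψ} v₀ ψL φ≗ψ = (swap-with-itself , ψL) ◅ ε
  where
  swap-with-itself : KempeSwap G φ ψ
  swap-with-itself = φ v₀ , φ v₀ , v₀ , inj₁ refl , λ u →
    (λ _ → trans (sym (φ≗ψ u)) (sym (swapC-self (φ v₀) (φ u)))) , (λ _ → sym (φ≗ψ u))

module Recolouring {n} (G : Graph n) (L : ListAssignment n) where

  open DecMembership (_≟F_ {n}) using () renaming (_∈?_ to _∈F?_)
  open DecMembership _≟ℕ_ using () renaming (_∈?_ to _∈ℕ?_)

  -- R lists the vertices still to be recoloured, E those already recoloured; all others keep their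
  -- colour under φ.
  Constrains : Coloring n → (E R : List (Fin n)) → Fin n → Pred (Fin n) 0ℓ
  Constrains φ E R y z = Adj G y z × z ∉ R × (z ∈ E ⊎ φ z ∈ L y)

  constrains? : ∀ φ E R y → Decidable (Constrains φ E R y)
  constrains? φ E R y z = Adj? G y z ×-dec ¬? (z ∈F? R) ×-dec (z ∈F? E ⊎-dec φ z ∈ℕ? L y)

  Degenerate : Coloring n → List (Fin n) → List (Fin n) → Set
  Degenerate φ E []       = ⊤
  Degenerate φ E (y ∷ ys) = count (constrains? φ E (y ∷ ys) y) < length (L y) × Degenerate φ (y ∷ E) ys

  Degenerate-weaken : ∀ {φ φ′ E E′} R → (∀ {z} → z ∈ E′ → z ∈ E) → (∀ z → z ∉ E → z ∉ R → φ′ z ≡ φ z) →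
                      Degenerate φ E R → Degenerate φ′ E′ R
  Degenerate-weaken []       _    _     _              = tt
  Degenerate-weaken {φ} {φ′} {E} {E′} (y ∷ ys) E′⊆E agree (load< , degenerate) =
    ≤-trans (s≤s (count-mono (constrains? φ′ E′ (y ∷ ys) y) (constrains? φ E (y ∷ ys) y)
                             constrains-weaken))
            load< ,
    Degenerate-weaken ys (λ { (here refl) → here refl ; (there z∈E′) → there (E′⊆E z∈E′) })
                      agree′ degenerate
    where
    constrains-weaken : Constrains φ′ E′ (y ∷ ys) y ⊆ Constrains φ E (y ∷ ys) y
    constrains-weaken (y~z , z∉R , inj₁ z∈E′) = y~z , z∉R , inj₁ (E′⊆E z∈E′)
    constrains-weaken {z} (y~z , z∉R , inj₂ φ′z∈L) with z ∈F? E
    ... | yes z∈E = y~z , z∉R , inj₁ z∈E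
    ... | no z∉E  = y~z , z∉R , inj₂ (subst (_∈ L y) (agree z z∉E z∉R) φ′z∈L)
    agree′ : ∀ z → z ∉ y ∷ E → z ∉ ys → φ′ z ≡ φ z
    agree′ z z∉yE z∉ys = agree z (z∉yE ∘ there) (∉-∷ (z∉yE ∘ here) z∉ys)

  ProperOutside : List (Fin n) → Coloring n → Set
  ProperOutside R f = ∀ u z → u ∉ R → z ∉ R → Adj G u z → f u ≢ f z

  ListedOutside : List (Fin n) → Coloring n → Set
  ListedOutside R f = ∀ z → z ∉ R → f z ∈ L z

  proper-update : ∀ {y ys f t} → ProperOutside (y ∷ ys) f → (∀ z → z ∉ y ∷ ys → Adj G y z → f z ≢ t) →
                  ProperOutside ys (f [ y ]≔ t)
  proper-update {y} {ys} {f} {t} proper free u z u∉ys z∉ys u~z with u ≟F y | z ≟F y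
  ... | yes refl | yes refl = contradiction u~z (Adj-irrefl G)
  ... | yes refl | no z≢y rewrite ≔-updates f u t | ≔-minimal f t z≢y =
    free z (∉-∷ z≢y z∉ys) u~z ∘ sym
  ... | no u≢y | yes refl rewrite ≔-updates f z t | ≔-minimal f t u≢y =
    free u (∉-∷ u≢y u∉ys) (Adj-sym G u~z)
  ... | no u≢y | no z≢y rewrite ≔-minimal f t u≢y | ≔-minimal f t z≢y =
    proper u z (∉-∷ u≢y u∉ys) (∉-∷ z≢y z∉ys) u~z

  listed-update : ∀ {y ys f t} → ListedOutside (y ∷ ys) f → t ∈ L y → ListedOutside ys (f [ y ]≔ t)
  listed-update {y} {ys} {f} {t} listed t∈L z z∉ys with z ≟F y
  ... | yes refl rewrite ≔-updates f z t = t∈L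
  ... | no z≢y   rewrite ≔-minimal f t z≢y = listed z (∉-∷ z≢y z∉ys)

  module Chain (x : Fin n) {a c : ℕ} (a≢c : a ≢ c) (φ : Coloring n) where

    open TwoColours a≢c

    InChain : List (Fin n) → Coloring n → Pred (Fin n) 0ℓ
    InChain R s w = w ∉ R × Swappable (s w)

    -- s is the colouring built so far and d its a,c-swap along the chain of x; both are only
    -- meaningful outside R, and outside R ∪ E they still agree with φ.
    record Invariant (R E : List (Fin n)) (s d : Coloring n) : Set where
      field
        s-proper : ProperOutside R s
        d-proper : ProperOutside R d
        s-listed : ListedOutside R s
        d-listed : ListedOutside R d
        d-swaps  : ∀ z → z ∉ R → d z ≡ s z ⊎ (d z ≡ swapC a c (s z) × Walk G (InChain R s) x z)
        closed   : ∀ u z → u ∉ R → z ∉ R → Adj G u z → d u ≢ s u → Swappable (s z) → d z ≢ s z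
        frozen   : ∀ z → z ∉ R → z ∉ E → s z ≡ φ z × d z ≡ s z

    record Extension (y : Fin n) (R : List (Fin n)) (s d : Coloring n) (ts td : ℕ) : Set where
      field
        ts∈L           : ts ∈ L y
        td∈L           : td ∈ L y
        s-free         : ∀ z → z ∉ R → Adj G y z → s z ≢ ts
        d-free         : ∀ z → z ∉ R → Adj G y z → d z ≢ td
        joins          : td ≡ ts ⊎ (td ≡ swapC a c ts × Swappable ts ×
                                    (y ≡ x ⊎ ∃ λ z₀ → z₀ ∉ R × Adj G z₀ y × d z₀ ≢ s z₀))
        swapped-closed : td ≢ ts → ∀ z → z ∉ R → Adj G y z → Swappable (s z) → d z ≢ s z
        kept-closed    : Swappable ts → ∀ u → u ∉ R → Adj G u y → d u ≢ s u → td ≢ ts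

    extend : ∀ {y ys E s d ts td} → y ∉ ys → Invariant (y ∷ ys) E s d → Extension y (y ∷ ys) s d ts td →
             Invariant ys (y ∷ E) (s [ y ]≔ ts) (d [ y ]≔ td)
    extend {y} {ys} {E} {s} {d} {ts} {td} y∉ys I X = record
      { s-proper = proper-update s-proper s-free
      ; d-proper = proper-update d-proper d-free
      ; s-listed = listed-update s-listed ts∈L
      ; d-listed = listed-update d-listed td∈L
      ; d-swaps  = d-swaps′
      ; closed   = closed′
      ; frozen   = frozen′
      }
      where
      open Invariant I
      open Extension X
      s′ d′ : Coloring n
      s′ = s [ y ]≔ ts
      d′ = d [ y ]≔ td

      chain-shrinks : InChain (y ∷ ys) s ⊆ InChain ys s′
      chain-shrinks {w} (w∉R , swappable) =
        w∉R ∘ there , subst Swappable (sym (≔-minimal s ts (w∉R ∘ here))) swappable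

      joined : td ≡ ts ⊎ (td ≡ swapC a c ts × Walk G (InChain ys s′) x y)
      joined with joins
      ... | inj₁ same = inj₁ same
      ... | inj₂ (swapped , swappable , origin) = inj₂ (swapped , walk origin)
        where
        y∈chain : InChain ys s′ y
        y∈chain = y∉ys , subst Swappable (sym (≔-updates s y ts)) swappable
        walk : (y ≡ x ⊎ ∃ λ z₀ → z₀ ∉ y ∷ ys × Adj G z₀ y × d z₀ ≢ s z₀) → Walk G (InChain ys s′) x y
        walk (inj₁ refl) = here y∈chain
        walk (inj₂ (z₀ , z₀∉R , z₀~y , changed)) with d-swaps z₀ z₀∉R
        ... | inj₁ same      = contradiction same changed
        ... | inj₂ (_ , w₀) = walk-snoc (walk-map chain-shrinks w₀) z₀~y y∈chain

      d-swaps′ : ∀ z → z ∉ ys → d′ z ≡ s′ z ⊎ (d′ z ≡ swapC a c (s′ z) × Walk G (InChain ys s′) x z)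
      d-swaps′ z z∉ys with z ≟F y
      ... | yes refl rewrite ≔-updates d z td | ≔-updates s z ts = joined
      ... | no z≢y rewrite ≔-minimal d td z≢y | ≔-minimal s ts z≢y with d-swaps z (∉-∷ z≢y z∉ys)
      ...   | inj₁ same           = inj₁ same
      ...   | inj₂ (swapped , w) = inj₂ (swapped , walk-map chain-shrinks w)

      closed′ : ∀ u z → u ∉ ys → z ∉ ys → Adj G u z → d′ u ≢ s′ u → Swappable (s′ z) → d′ z ≢ s′ z
      closed′ u z u∉ys z∉ys u~z with u ≟F y | z ≟F y
      ... | yes refl | yes refl = contradiction u~z (Adj-irrefl G)
      ... | yes refl | no z≢y
        rewrite ≔-updates s u ts | ≔-updates d u td | ≔-minimal s ts z≢y | ≔-minimal d td z≢y =
        λ changed → swapped-closed changed z (∉-∷ z≢y z∉ys) u~z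
      ... | no u≢y | yes refl
        rewrite ≔-updates s z ts | ≔-updates d z td | ≔-minimal s ts u≢y | ≔-minimal d td u≢y =
        λ changed swappable → kept-closed swappable u (∉-∷ u≢y u∉ys) u~z changed
      ... | no u≢y | no z≢y
        rewrite ≔-minimal s ts u≢y | ≔-minimal d td u≢y | ≔-minimal s ts z≢y | ≔-minimal d td z≢y =
        closed u z (∉-∷ u≢y u∉ys) (∉-∷ z≢y z∉ys) u~z

      frozen′ : ∀ z → z ∉ ys → z ∉ y ∷ E → s′ z ≡ φ z × d′ z ≡ s′ z
      frozen′ z z∉ys z∉yE rewrite ≔-minimal s ts (z∉yE ∘ here) | ≔-minimal d td (z∉yE ∘ here) =
        frozen z (∉-∷ (z∉yE ∘ here) z∉ys) (z∉yE ∘ there)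

    start-invariant : ∀ {R} → IsLColoring G L φ → Invariant R [] φ φ
    start-invariant (proper , listed) = record
      { s-proper = λ u z _ _ → proper u z
      ; d-proper = λ u z _ _ → proper u z
      ; s-listed = λ z _ → listed z
      ; d-listed = λ z _ → listed z
      ; d-swaps  = λ _ _ → inj₁ refl
      ; closed   = λ _ _ _ _ _ changed _ → contradiction refl changed
      ; frozen   = λ _ _ _ → refl , refl
      }

    start-extension : ∀ {os ψ} → IsLColoring G L φ → IsLColoring G L ψ → φ x ≡ a → ψ x ≡ c →
                      (∀ z → z ∉ x ∷ os → φ z ≡ ψ z) → Extension x (x ∷ os) φ φ a c
    start-extension {os} (φ-proper , φ-listed) (ψ-proper , ψ-listed) refl refl agree = record
      { ts∈L           = φ-listed x
      ; td∈L           = ψ-listed x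
      ; s-free         = λ z _ x~z → φ-proper x z x~z ∘ sym
      ; d-free         = d-free
      ; joins          = inj₂ (sym (swapC-α a c) , inj₁ refl , inj₁ refl)
      ; swapped-closed = λ _ z z∉R x~z swappable → contradiction swappable (unswappable z z∉R x~z)
      ; kept-closed    = λ _ _ _ _ changed → contradiction refl changed
      }
      where
      d-free : ∀ z → z ∉ x ∷ os → Adj G x z → φ z ≢ c
      d-free z z∉R x~z φz≡c = ψ-proper x z x~z (sym (trans (sym (agree z z∉R)) φz≡c))
      unswappable : ∀ z → z ∉ x ∷ os → Adj G x z → ¬ Swappable (φ z)
      unswappable z z∉R x~z (inj₁ φz≡a) = φ-proper x z x~z (sym φz≡a)
      unswappable z z∉R x~z (inj₂ φz≡c) = d-free z z∉R x~z φz≡c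

    invariant⇒kempe-swap : ∀ {E s d} → Invariant [] E s d → s x ≡ a → d x ≡ c → KempeSwapAt G s a c x d
    invariant⇒kempe-swap {s = s} {d} I sx≡a dx≡c = inj₁ sx≡a , λ u → on-chain u , off-chain u
      where
      open Invariant I
      changed-along : ∀ {p u} → d p ≢ s p → Walk G (Swappable ∘ s) p u → d u ≢ s u
      changed-along changed (here _)          = changed
      changed-along changed (step _ p~q walk) =
        changed-along (closed _ _ (λ ()) (λ ()) p~q changed (walk-head walk)) walk
      x-changed : d x ≢ s x
      x-changed dx≡sx = a≢c (trans (sym sx≡a) (trans (sym dx≡sx) dx≡c))
      on-chain : ∀ u → Walk G (Swappable ∘ s) x u → d u ≡ swapC a c (s u)
      on-chain u walk with d-swaps u (λ ())
      ... | inj₁ same          = contradiction same (changed-along x-changed walk)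
      ... | inj₂ (swapped , _) = swapped
      off-chain : ∀ u → ¬ Walk G (Swappable ∘ s) x u → d u ≡ s u
      off-chain u ¬walk with d-swaps u (λ ())
      ... | inj₁ same     = same
      ... | inj₂ (_ , walk) = contradiction (walk-map proj₂ walk) ¬walk

    invariant⇒colourings : ∀ {E s d} → Invariant [] E s d → IsLColoring G L s × IsLColoring G L d
    invariant⇒colourings I = ((λ u z → s-proper u z (λ ()) (λ ())) , (λ z → s-listed z (λ ()))) ,
                             ((λ u z → d-proper u z (λ ()) (λ ())) , (λ z → d-listed z (λ ())))
      where open Invariant I

    module Step {y ys E s d} (I : Invariant (y ∷ ys) E s d)
                (load< : count (constrains? φ E (y ∷ ys) y) < length (L y)) (Ly-unique : Unique (L y)) where

      open Invariant I

      R : List (Fin n)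
      R = y ∷ ys

      Covered : (Fin n → ℕ) → ℕ → Set
      Covered h t = ∃ λ z → Constrains φ E R y z × h z ≡ t

      overloaded : (h : Fin n → ℕ) → (∀ {t} → t ∈ L y → Covered h t) → ⊥
      overloaded h cover = <⇒≱ load< (length≤count (constrains? φ E R y) h Ly-unique cover)

      Blocks : ℕ → Pred (Fin n) 0ℓ
      Blocks t z = Adj G y z × z ∉ R × s z ≡ t

      blocks? : ∀ t → Decidable (Blocks t)
      blocks? t z = Adj? G y z ×-dec ¬? (z ∈F? R) ×-dec (s z ≟ℕ t)

      blocks⇒constrains : ∀ {t z} → t ∈ L y → Blocks t z → Constrains φ E R y z
      blocks⇒constrains {z = z} t∈L (y~z , z∉R , refl) with z ∈F? E
      ... | yes z∈E = y~z , z∉R , inj₁ z∈E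
      ... | no z∉E  = y~z , z∉R , inj₂ (subst (_∈ L y) (proj₁ (frozen z z∉R z∉E)) t∈L)

      blocks⇒covered : ∀ {t} → t ∈ L y → ∃ (Blocks t) → Covered s t
      blocks⇒covered t∈L (z , blocks) = z , blocks⇒constrains t∈L blocks , proj₂ (proj₂ blocks)

      Changed : Pred (Fin n) 0ℓ
      Changed z = Adj G y z × z ∉ R × d z ≢ s z

      changed? : Decidable Changed
      changed? z = Adj? G y z ×-dec ¬? (z ∈F? R) ×-dec ¬? (d z ≟ℕ s z)

      kept-extension : ∀ {t} → t ∈ L y → ¬ ∃ (Blocks t) → (∀ z → z ∉ R → Adj G y z → d z ≢ t) →
                       (Swappable t → ¬ ∃ Changed) → Extension y R s d t t
      kept-extension t∈L free d-free unchanged = record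
        { ts∈L           = t∈L
        ; td∈L           = t∈L
        ; s-free         = λ z z∉R y~z sz≡t → free (z , y~z , z∉R , sz≡t)
        ; d-free         = d-free
        ; joins          = inj₁ refl
        ; swapped-closed = λ t≢t → contradiction refl t≢t
        ; kept-closed    = λ swappable u u∉R u~y changed →
                             contradiction (u , Adj-sym G u~y , u∉R , changed) (unchanged swappable)
        }

      fresh-extension : ∀ {t} → t ∈ L y → ¬ Swappable t → ¬ ∃ (Blocks t) → Extension y R s d t t
      fresh-extension {t} t∈L unswappable free =
        kept-extension t∈L free d-free (λ swappable → contradiction swappable unswappable)
        where
        d-free : ∀ z → z ∉ R → Adj G y z → d z ≢ t
        d-free z z∉R y~z dz≡t with d-swaps z z∉R
        ... | inj₁ dz≡sz            = free (z , y~z , z∉R , trans (sym dz≡sz) dz≡t)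
        ... | inj₂ (swapped , walk) =
          unswappable (subst Swappable (trans (sym swapped) dz≡t) (swap-swappable (proj₂ (walk-last walk))))

      unchanged-extension : ∀ {t} → t ∈ L y → ¬ ∃ (Blocks t) → ¬ ∃ Changed → Extension y R s d t t
      unchanged-extension {t} t∈L free unchanged = kept-extension t∈L free d-free (const unchanged)
        where
        d-free : ∀ z → z ∉ R → Adj G y z → d z ≢ t
        d-free z z∉R y~z dz≡t = free (z , y~z , z∉R , trans (sym dz≡sz) dz≡t)
          where
          dz≡sz : d z ≡ s z
          dz≡sz = decidable-stable (d z ≟ℕ s z) λ changed → unchanged (z , y~z , z∉R , changed)

      -- z₀ was swapped from sc to t₀, so y can only follow it into the chain by taking t₀ in s
      -- and sc in d. Should this fail, the colours of L y can be matched injectively to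
      -- constraining neighbours (recolouring z₀ to t₀ where needed), against the load bound.
      module AroundChanged {z₀} (y~z₀ : Adj G y z₀) (z₀∉R : z₀ ∉ R) (changed₀ : d z₀ ≢ s z₀)
                           (blocked : ∀ {t} → t ∈ L y → ¬ Swappable t → ∃ (Blocks t)) where

        sc t₀ : ℕ
        sc = s z₀
        t₀ = swapC a c sc

        swappable₀ : Swappable sc
        swappable₀ with d-swaps z₀ z₀∉R
        ... | inj₁ same      = contradiction same changed₀
        ... | inj₂ (_ , walk) = proj₂ (walk-last walk)

        constrains₀ : Constrains φ E R y z₀
        constrains₀ = y~z₀ , z₀∉R , inj₁ (decidable-stable (z₀ ∈F? E) λ z₀∉E →
                                                changed₀ (proj₂ (frozen z₀ z₀∉R z₀∉E)))

        overloaded-unless : (h : Fin n → ℕ) → (∀ {z} → z ≢ z₀ → h z ≡ s z) →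
                            (sc ∈ L y → Covered h sc) → (t₀ ∈ L y → Covered h t₀) → ⊥
        overloaded-unless h h≈s cover-sc cover-t₀ = overloaded h cover
          where
          cover : ∀ {t} → t ∈ L y → Covered h t
          cover {t} t∈L with t ≟ℕ sc | t ≟ℕ t₀
          ... | yes refl | _        = cover-sc t∈L
          ... | no _     | yes refl = cover-t₀ t∈L
          ... | no t≢sc  | no t≢t₀
            with blocked t∈L ([ t≢sc , t≢t₀ ]′ ∘ swappable-cases swappable₀)
          ...   | z , blocks@(_ , _ , sz≡t) =
            z , blocks⇒constrains t∈L blocks , trans (h≈s λ { refl → t≢sc (sym sz≡t) }) sz≡t

        shifted : Coloring n
        shifted = s [ z₀ ]≔ t₀

        shifted≈s : ∀ {z} → z ≢ z₀ → shifted z ≡ s z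
        shifted≈s = ≔-minimal s t₀

        Rival : Pred (Fin n) 0ℓ
        Rival z = Adj G y z × z ∉ R × z ≢ z₀ × Swappable (s z)

        rival? : Decidable Rival
        rival? z = Adj? G y z ×-dec ¬? (z ∈F? R) ×-dec ¬? (z ≟F z₀) ×-dec swappable? (s z)

        swap-extension : t₀ ∈ L y → sc ∈ L y → ¬ ∃ Rival → Extension y R s d t₀ sc
        swap-extension t₀∈L sc∈L alone = record
          { ts∈L           = t₀∈L
          ; td∈L           = sc∈L
          ; s-free         = s-free
          ; d-free         = d-free
          ; joins          = inj₂ (sym (swap-involutive swappable₀) , swap-swappable swappable₀ ,
                                   inj₂ (z₀ , z₀∉R , Adj-sym G y~z₀ , changed₀))
          ; swapped-closed = λ _ z z∉R y~z swappable →
                               subst (λ w → d w ≢ s w) (sym (only z z∉R y~z swappable)) changed₀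
          ; kept-closed    = λ _ _ _ _ _ sc≡t₀ → swap-≢ swappable₀ (sym sc≡t₀)
          }
          where
          only : ∀ z → z ∉ R → Adj G y z → Swappable (s z) → z ≡ z₀
          only z z∉R y~z swappable =
            decidable-stable (z ≟F z₀) λ z≢z₀ → alone (z , y~z , z∉R , z≢z₀ , swappable)
          s-free : ∀ z → z ∉ R → Adj G y z → s z ≢ t₀
          s-free z z∉R y~z sz≡t₀
            with only z z∉R y~z (subst Swappable (sym sz≡t₀) (swap-swappable swappable₀))
          ... | refl = swap-≢ swappable₀ (sym sz≡t₀)
          d-free : ∀ z → z ∉ R → Adj G y z → d z ≢ sc
          d-free z z∉R y~z dz≡sc with d-swaps z z∉R
          ... | inj₁ dz≡sz with only z z∉R y~z (subst Swappable (trans (sym dz≡sc) dz≡sz) swappable₀)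
          ...   | refl = changed₀ dz≡sz
          d-free z z∉R y~z dz≡sc | inj₂ (swapped , walk) with only z z∉R y~z (proj₂ (walk-last walk))
          ...   | refl = swap-≢ swappable₀ (trans (sym swapped) dz≡sc)

        extension : ∃₂ (Extension y R s d)
        extension with t₀ ∈ℕ? L y | sc ∈ℕ? L y | Finₚ.any? rival?
        ... | no t₀∉L | _ | _ = ⊥-elim (overloaded-unless s (λ _ → refl)
                                  (λ _ → z₀ , constrains₀ , refl) (λ t₀∈L → contradiction t₀∈L t₀∉L))
        ... | yes _ | no sc∉L | _ = ⊥-elim (overloaded-unless shifted shifted≈s
                                  (λ sc∈L → contradiction sc∈L sc∉L)
                                  (λ _ → z₀ , constrains₀ , ≔-updates s z₀ t₀))
        ... | yes t₀∈L | yes sc∈L | yes (z₁ , y~z₁ , z₁∉R , z₁≢z₀ , swappable₁)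
          with swappable-cases swappable₀ swappable₁
        ...   | inj₁ s₁≡sc = ⊥-elim (overloaded-unless shifted shifted≈s
                               (λ _ → z₁ , blocks⇒constrains sc∈L (y~z₁ , z₁∉R , s₁≡sc) ,
                                      trans (shifted≈s z₁≢z₀) s₁≡sc)
                               (λ _ → z₀ , constrains₀ , ≔-updates s z₀ t₀))
        ...   | inj₂ s₁≡t₀ = ⊥-elim (overloaded-unless s (λ _ → refl)
                               (λ _ → z₀ , constrains₀ , refl)
                               (λ _ → blocks⇒covered t₀∈L (z₁ , y~z₁ , z₁∉R , s₁≡t₀)))
        extension | yes t₀∈L | yes sc∈L | no alone = t₀ , sc , swap-extension t₀∈L sc∈L alone

      extension : ∃₂ (Extension y R s d)
      extension with any? (λ t → ¬? (swappable? t) ×-dec ¬? (Finₚ.any? (blocks? t))) (L y)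
      ... | yes fresh with find fresh
      ...   | t , t∈L , unswappable , free = t , t , fresh-extension t∈L unswappable free
      extension | no no-fresh with Finₚ.any? changed?
      ... | yes (z₀ , y~z₀ , z₀∉R , changed₀) = AroundChanged.extension y~z₀ z₀∉R changed₀ blocked
        where
        blocked : ∀ {t} → t ∈ L y → ¬ Swappable t → ∃ (Blocks t)
        blocked t∈L unswappable =
          decidable-stable (Finₚ.any? (blocks? _)) λ free → no-fresh (lose t∈L (unswappable , free))
      ... | no unchanged with any? (λ t → ¬? (Finₚ.any? (blocks? t))) (L y)
      ...   | yes some with find some
      ...     | t , t∈L , free = t , t , unchanged-extension t∈L free unchanged
      extension | no _ | no _ | no none = ⊥-elim (overloaded s λ t∈L →
        blocks⇒covered t∈L ((decidable-stable (Finₚ.any? (blocks? _)) (none ∘ lose t∈L))))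

    recolour : (∀ v → Unique (L v)) → ∀ R {E s d} → Unique R → Degenerate φ E R → Invariant R E s d →
               ∃₂ λ s′ d′ → ∃ (λ E′ → Invariant [] E′ s′ d′) × (∀ z → z ∉ R → s′ z ≡ s z × d′ z ≡ d z)
    recolour unique [] _ _ I = _ , _ , (_ , I) , λ _ _ → refl , refl
    recolour unique (y ∷ ys) {s = s} {d} (y∉ys ∷ ys-unique) (load< , degenerate) I
      with Step.extension I load< (unique y)
    ... | ts , td , X with recolour unique ys ys-unique degenerate (extend (All¬⇒¬Any y∉ys) I X)
    ...   | s′ , d′ , I′ , agree = s′ , d′ , I′ , agree′
      where
      agree′ : ∀ z → z ∉ y ∷ ys → s′ z ≡ s z × d′ z ≡ d z
      agree′ z z∉R with agree z (z∉R ∘ there)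
      ... | s′≡ , d′≡ = trans s′≡ (≔-minimal s ts (z∉R ∘ here)) , trans d′≡ (≔-minimal d td (z∉R ∘ here))

    kempe-bridge : (∀ v → Unique (L v)) → ∀ {os ψ} → x ∉ os → Unique os →
                   IsLColoring G L φ → IsLColoring G L ψ → φ x ≡ a → ψ x ≡ c →
                   (∀ z → z ∉ x ∷ os → φ z ≡ ψ z) → Degenerate φ (x ∷ []) os →
                   ∃₂ λ s d → LKempeStep G L s d × IsLColoring G L s ×
                              (∀ z → z ∉ os → s z ≡ φ z) × (∀ z → z ∉ os → d z ≡ ψ z)
    kempe-bridge unique {os} {ψ} x∉os os-unique φL ψL φx≡a ψx≡c agree degenerate
      with recolour unique os os-unique degenerate
             (extend x∉os (start-invariant φL) (start-extension φL ψL φx≡a ψx≡c agree))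
    ... | s , d , (_ , I) , agree′ =
      s , d , ((a , c , x , invariant⇒kempe-swap I sx≡a dx≡c) , proj₂ colourings) , proj₁ colourings ,
      s≈φ , d≈ψ
      where
      colourings : IsLColoring G L s × IsLColoring G L d
      colourings = invariant⇒colourings I
      sx≡a : s x ≡ a
      sx≡a = trans (proj₁ (agree′ x x∉os)) (≔-updates φ x a)
      dx≡c : d x ≡ c
      dx≡c = trans (proj₂ (agree′ x x∉os)) (≔-updates φ x c)
      s≈φ : ∀ z → z ∉ os → s z ≡ φ z
      s≈φ z z∉os with z ≟F x
      ... | yes refl = trans sx≡a (sym φx≡a)
      ... | no z≢x   = trans (proj₁ (agree′ z z∉os)) (≔-minimal φ a z≢x)
      d≈ψ : ∀ z → z ∉ os → d z ≡ ψ z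
      d≈ψ z z∉os with z ≟F x
      ... | yes refl = trans dx≡c (sym ψx≡c)
      ... | no z≢x   = trans (proj₂ (agree′ z z∉os)) (trans (≔-minimal φ c z≢x) (agree z (∉-∷ z≢x z∉os)))

  kempe-equivalent : Fin n → (∀ v → Unique (L v)) → ∀ os → Unique os → ∀ {φ ψ} →
                     IsLColoring G L φ → IsLColoring G L ψ → (∀ z → z ∉ os → φ z ≡ ψ z) →
                     Degenerate φ [] os → LEquivalent G L φ ψ
  kempe-equivalent v₀ unique [] _ _ ψL agree _ = ≗⇒LEquivalent v₀ ψL λ z → agree z λ ()
  kempe-equivalent v₀ unique (x ∷ os) (x∉os ∷ os-unique) {φ} {ψ} φL ψL agree (_ , degenerate)
    with φ x ≟ℕ ψ x
  ... | yes φx≡ψx = kempe-equivalent v₀ unique os os-unique φL ψL agree′ degenerate-φ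
    where
    agree′ : ∀ z → z ∉ os → φ z ≡ ψ z
    agree′ z z∉os with z ≟F x
    ... | yes refl = φx≡ψx
    ... | no z≢x   = agree z (∉-∷ z≢x z∉os)
    degenerate-φ : Degenerate φ [] os
    degenerate-φ = Degenerate-weaken os (λ ()) (λ _ _ _ → refl) degenerate
  ... | no φx≢ψx
    with Chain.kempe-bridge x φx≢ψx φ unique (All¬⇒¬Any x∉os) os-unique φL ψL refl refl agree degenerate
  ...   | s , d , kempe-step , sL , s≈φ , d≈ψ =
    kempe-equivalent v₀ unique os os-unique φL sL (λ z z∉os → sym (s≈φ z z∉os)) degenerate-φ ◅◅
    kempe-step ◅ kempe-equivalent v₀ unique os os-unique (proj₂ kempe-step) ψL d≈ψ degenerate-d
    where
    degenerate-φ : Degenerate φ [] os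
    degenerate-φ = Degenerate-weaken os (λ ()) (λ _ _ _ → refl) degenerate
    degenerate-d : Degenerate d [] os
    degenerate-d = Degenerate-weaken os (λ ()) (λ z z∉x z∉os →
                     trans (d≈ψ z z∉os) (sym (agree z (∉-∷ (z∉x ∘ here) z∉os)))) degenerate

module Ordering {n} (G : Graph n) (L : ListAssignment n) (v : Fin n) (α : ℕ) where

  open Recolouring G L using (Constrains; constrains?; Degenerate)
  open DecMembership (_≟F_ {n}) using () renaming (_∈?_ to _∈F?_)

  Rooted : List (Fin n) → Set
  Rooted []      = ⊤
  Rooted (y ∷ R) = (∃ λ u → Adj G y u × (u ∈ R ⊎ (u ≡ v × α ∉ L y))) × Rooted R

  -- The neighbour u witnessing Rooted is still to be recoloured, or is v with colour α ∉ L y; either way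
  -- it does not constrain y, so a degree assignment leaves y a spare colour.
  rooted⇒degenerate : IsDegreeAssignment G L → ∀ {φ} → φ v ≡ α →
                      ∀ os {E} → Rooted os → v ∉ os → v ∉ E → Degenerate φ E os
  rooted⇒degenerate deg φv≡α [] _ _ _ = tt
  rooted⇒degenerate deg {φ} φv≡α (y ∷ R) {E} ((u , y~u , later) , rooted) v∉os v∉E =
    subst (count (constrains? φ E (y ∷ R) y) <_) (trans (sym (degree≡count G y)) (sym (proj₂ (deg y))))
          (count-< (constrains? φ E (y ∷ R) y) (Adj? G y) proj₁ y~u (unconstrained later)) ,
    rooted⇒degenerate deg φv≡α R rooted (v∉os ∘ there) (∉-∷ (λ { refl → v∉os (here refl) }) v∉E)
    where
    unconstrained : u ∈ R ⊎ (u ≡ v × α ∉ L y) → ¬ Constrains φ E (y ∷ R) y u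
    unconstrained later (_ , u∉yR , u∈E⊎φu∈L) with later
    ... | inj₁ u∈R               = u∉yR (there u∈R)
    ... | inj₂ (refl , α∉L) with u∈E⊎φu∈L
    ...   | inj₁ v∈E   = v∉E v∈E
    ...   | inj₂ φv∈L = α∉L (subst (_∈ L y) φv≡α φv∈L)

  record RootedOrder : Set where
    field
      order   : List (Fin n)
      unique  : Unique order
      v∉order : v ∉ order
      rooted  : Rooted order

  open RootedOrder

  frontier : ∀ R {z t} → Walk G (_≢ v) z t → t ∈ R → z ∉ R →
             ∃₂ λ y u → y ∉ R × y ≢ v × Adj G y u × u ∈ R
  frontier R (here _) t∈R z∉R = contradiction t∈R z∉R
  frontier R {z} (step {y = z₁} z≢v z~z₁ walk) t∈R z∉R with z₁ ∈F? R
  ... | yes z₁∈R = z , z₁ , z∉R , z≢v , z~z₁ , z₁∈R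
  ... | no z₁∉R  = frontier R walk t∈R z₁∉R

  prepend : (O : RootedOrder) → ∀ {y u} → y ∉ order O → y ≢ v → Adj G y u → u ∈ order O → RootedOrder
  prepend O y∉O y≢v y~u u∈O = record
    { order   = _ ∷ order O
    ; unique  = ¬Any⇒All¬ _ y∉O ∷ unique O
    ; v∉order = ∉-∷ (y≢v ∘ sym) (v∉order O)
    ; rooted  = (_ , y~u , inj₁ u∈O) , rooted O
    }

  Spanning : RootedOrder → Set
  Spanning O = ∀ z → z ≢ v → z ∈ order O

  -- The fuel suffices: each round lengthens the order, which is shorter than n while it misses a vertex.
  span : ConnectedMinus G v → ∀ {w} → w ≢ v → ∀ fuel (O : RootedOrder) → w ∈ order O →
         n ≤ fuel + length (order O) → Σ RootedOrder Spanning
  span conn w≢v fuel O w∈O bound with Finₚ.any? (λ z → ¬? (z ≟F v) ×-dec ¬? (z ∈F? order O))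
  ... | no complete = O , λ z z≢v → decidable-stable (z ∈F? order O) λ z∉O → complete (z , z≢v , z∉O)
  span conn w≢v zero O w∈O bound | yes (z , _ , z∉O) =
    contradiction bound (<⇒≱ (length<n (unique O) z∉O))
  span conn w≢v (suc fuel) O w∈O bound | yes (z , z≢v , z∉O)
    with frontier (order O) (conn z _ z≢v w≢v) w∈O z∉O
  ... | y , u , y∉O , y≢v , y~u , u∈O =
    span conn w≢v fuel (prepend O y∉O y≢v y~u u∈O) (there w∈O) (subst (n ≤_) (sym (+-suc fuel _)) bound)

  spanning-order : ConnectedMinus G v → ∀ {w} → Adj G v w → α ∉ L w → Σ RootedOrder Spanning
  spanning-order conn {w} v~w α∉Lw = span conn w≢v n singleton (here refl) (m≤m+n n 1)
    where
    w≢v : w ≢ v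
    w≢v refl = Adj-irrefl G v~w
    singleton : RootedOrder
    singleton = record
      { order   = w ∷ []
      ; unique  = All.[] ∷ []
      ; v∉order = ∉-∷ (w≢v ∘ sym) λ ()
      ; rooted  = (v , Adj-sym G v~w , inj₂ (refl , α∉Lw)) , tt
      }

corollary8 : ∀ {n} (G : Graph n) (L : ListAssignment n) → IsDegreeAssignment G L →
    (v : Fin n) → ConnectedMinus G v → (α : ℕ) → α ∈ L v →
    Σ (Fin n) (λ w → Adj G v w × α ∉ L w) →
    Mixes G L (Lvα v α)
corollary8 G L deg v conn α _ (w , v~w , α∉Lw) φ ψ φL φv≡α ψL ψv≡α =
  kempe-equivalent v (proj₁ ∘ deg) order unique φL ψL agree
    (rooted⇒degenerate deg φv≡α order rooted v∉order λ ())
  where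
  open Recolouring G L using (kempe-equivalent)
  open Ordering G L v α
  spanning : Σ RootedOrder Spanning
  spanning = spanning-order conn v~w α∉Lw
  open RootedOrder (proj₁ spanning)
  agree : ∀ z → z ∉ order → φ z ≡ ψ z
  agree z z∉order with z ≟F v
  ... | yes refl = trans φv≡α (sym ψv≡α)
  ... | no z≢v   = contradiction (proj₂ spanning z z≢v) z∉order
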